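{- A dynamical system $\langle\mathbb A,\alpha\rangle$ is incompressible if and only if the digraph $\langle\mathcal A,\to_\alpha\rangle$ is strongly connected for every partition $\mathcal A$ of $\mathbb A$.
   Context: A dynamical system is a Boolean algebra $\mathbb A$ with an automorphism $\alpha$; it is incompressible if no $x\in\mathbb A\setminus\{\mathbf 0,\mathbf 1\}$ has $\alpha(x)\le x$. A partition of $\mathbb A$ is a finite set of nonzero, pairwise disjoint elements whose join is $\mathbf 1$. For a partition $\mathcal A$, the digraph $\langle\mathcal A,\to_\alpha\rangle$ has vertex set $\mathcal A$ and $x\to_\alpha y$ iff $\alpha(x)\wedge y\neq\mathbf 0$. A digraph is strongly connected if for any vertices $a,b$ there is a walk (finite sequence of vertices, each related to the next by the edge relation) from $a$ to $b$. -}

module Defs where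

open import Level using (Level; _⊔_)
open import Data.Nat using (ℕ; zero; suc)
open import Data.Fin using (Fin; zero; suc)
open import Data.Product using (Σ; _×_; ∃)
open import Relation.Nullary using (¬_)
open import Relation.Binary.PropositionalEquality using (_≡_)
open import Relation.Binary.Construct.Closure.ReflexiveTransitive using (Star)
open import Algebra.Lattice.Bundles using (BooleanAlgebra)

module _ {c ℓ : Level} (𝔸 : BooleanAlgebra c ℓ) where
  open BooleanAlgebra 𝔸 renaming (¬_ to ∁_)

  _≤ᴮ_ : Carrier → Carrier → Set ℓ
  x ≤ᴮ y = (x ∧ y) ≈ x

  record IsAutomorphism (α : Carrier → Carrier) : Set (c ⊔ ℓ) where
    field
      cong       : ∀ {x y} → x ≈ y → α x ≈ α y
      ∨-homo     : ∀ x y → α (x ∨ y) ≈ (α x ∨ α y)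
      ∧-homo     : ∀ x y → α (x ∧ y) ≈ (α x ∧ α y)
      ¬-homo     : ∀ x → α (∁ x) ≈ (∁ α x)
      ⊤-homo     : α ⊤ ≈ ⊤
      ⊥-homo     : α ⊥ ≈ ⊥
      injective  : ∀ {x y} → α x ≈ α y → x ≈ y
      surjective : ∀ y → Σ Carrier (λ x → α x ≈ y)

  Incompressible : (Carrier → Carrier) → Set (c ⊔ ℓ)
  Incompressible α = ¬ (Σ Carrier (λ x → (x ≉ ⊥) × (x ≉ ⊤) × (α x ≤ᴮ x)))

  ⋁ : ∀ {n} → (Fin n → Carrier) → Carrier
  ⋁ {zero}  p = ⊥
  ⋁ {suc n} p = p zero ∨ ⋁ (λ i → p (suc i))

  record IsPartition {n : ℕ} (p : Fin n → Carrier) : Set ℓ where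
    field
      nonzero  : ∀ i → p i ≉ ⊥
      disjoint : ∀ i j → ¬ (i ≡ j) → (p i ∧ p j) ≈ ⊥
      covers   : ⋁ p ≈ ⊤

  Edge : (Carrier → Carrier) → ∀ {n} → (Fin n → Carrier) → Fin n → Fin n → Set ℓ
  Edge α p i j = (α (p i) ∧ p j) ≉ ⊥

StronglyConnected : ∀ {ℓ} {n : ℕ} → (Fin n → Fin n → Set ℓ) → Set ℓ
StronglyConnected {n = n} E = (a b : Fin n) → Star E a b

-- If α is incompressible and 𝒜 is a partition, the join y of the blocks reachable from a
-- block a satisfies α y ≤ y, since no edge leaves the reachable set; y contains a, so
-- y = 1 and every block is reachable. Conversely, a compressible x ∉ {0,1} yields the
-- partition {x, ∁x} in which no edge leads from x to ∁x.
module Submission where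

open import Defs
open import Level using (Level)
open import Data.Nat using (ℕ)
open import Data.Fin using (Fin; zero; suc)
open import Data.Product using (_,_)
open import Data.Empty using (⊥-elim)
open import Function.Base using (id; _∘_)
open import Function.Bundles using (_⇔_; mk⇔)
open import Axiom.ExcludedMiddle using (ExcludedMiddle)
open import Axiom.DoubleNegationElimination using (DoubleNegationElimination; em⇒dne)
open import Algebra.Lattice.Bundles using (BooleanAlgebra)
open import Relation.Nullary using (¬_; yes; no)
open import Relation.Unary using (Pred; Decidable)
open import Relation.Binary using (Rel)
open import Relation.Binary.PropositionalEquality as ≡ using (_≡_)
open import Relation.Binary.Construct.Closure.ReflexiveTransitive using (Star; ε; _◅_; _◅◅_; fold)
import Algebra.Lattice.Properties.BooleanAlgebra as BooleanAlgebraProperties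
import Relation.Binary.Lattice.Bundles as OrderTheoretic
import Relation.Binary.Reasoning.Setoid as SetoidReasoning

Star-preserves : ∀ {i e p} {I : Set i} {E : Rel I e} (P : Pred I p) →
                 (∀ {i j} → E i j → P i → P j) → ∀ {i j} → Star E i j → P i → P j
Star-preserves P step = fold (λ i j → P i → P j) (λ e k → k ∘ step e) id

module _ {c ℓ : Level} (𝔸 : BooleanAlgebra c ℓ) where
  open BooleanAlgebra 𝔸 renaming (¬_ to ∁_; refl to ≈-refl)
  open BooleanAlgebraProperties 𝔸
  open OrderTheoretic.Lattice ∨-∧-orderTheoreticLattice
    using (_≤_; x≤x∨y; y≤x∨y; ∨-least; x∧y≤y)
    renaming (reflexive to ≤-reflexive; trans to ≤-trans)
  open SetoidReasoning setoid

  -- The library's lattice order reads x ≈ x ∧ y, whereas _≤ᴮ_ reads (x ∧ y) ≈ x.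
  ≤⇒≤ᴮ : ∀ {x y} → x ≤ y → _≤ᴮ_ 𝔸 x y
  ≤⇒≤ᴮ = sym

  ≤ᴮ⇒≤ : ∀ {x y} → _≤ᴮ_ 𝔸 x y → x ≤ y
  ≤ᴮ⇒≤ = sym

  ⊥≤ : ∀ x → ⊥ ≤ x
  ⊥≤ x = sym (∧-zeroˡ x)

  ≤⊥⇒≈⊥ : ∀ {x} → x ≤ ⊥ → x ≈ ⊥
  ≤⊥⇒≈⊥ {x} x≤⊥ = trans x≤⊥ (∧-zeroʳ x)

  ≤⇒∧∁≈⊥ : ∀ {x y} → x ≤ y → x ∧ ∁ y ≈ ⊥
  ≤⇒∧∁≈⊥ {x} {y} x≤y = begin
    x ∧ ∁ y        ≈⟨ ∧-congʳ x≤y ⟩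
    (x ∧ y) ∧ ∁ y  ≈⟨ ∧-assoc x y (∁ y) ⟩
    x ∧ (y ∧ ∁ y)  ≈⟨ ∧-congˡ (∧-complementʳ y) ⟩
    x ∧ ⊥          ≈⟨ ∧-zeroʳ x ⟩
    ⊥              ∎

  ∁≈⊥⇒≈⊤ : ∀ {x} → ∁ x ≈ ⊥ → x ≈ ⊤
  ∁≈⊥⇒≈⊤ {x} ∁x≈⊥ = begin
    x      ≈⟨ sym (¬-involutive x) ⟩
    ∁ ∁ x  ≈⟨ ¬-cong ∁x≈⊥ ⟩
    ∁ ⊥    ≈⟨ ¬⊥≈⊤ ⟩
    ⊤      ∎

  x≤⋁ : ∀ {n} (p : Fin n → Carrier) i → p i ≤ ⋁ 𝔸 p
  x≤⋁ p zero    = x≤x∨y _ _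
  x≤⋁ p (suc i) = ≤-trans (x≤⋁ (p ∘ suc) i) (y≤x∨y _ _)

  ⋁-least : ∀ {n} {p : Fin n → Carrier} {z} → (∀ i → p i ≤ z) → ⋁ 𝔸 p ≤ z
  ⋁-least {ℕ.zero}  p≤z = ⊥≤ _
  ⋁-least {ℕ.suc n} p≤z = ∨-least (p≤z zero) (⋁-least (p≤z ∘ suc))

  ∧-distribˡ-⋁ : ∀ {n} x (p : Fin n → Carrier) → x ∧ ⋁ 𝔸 p ≈ ⋁ 𝔸 (λ i → x ∧ p i)
  ∧-distribˡ-⋁ {ℕ.zero}  x p = ∧-zeroʳ x
  ∧-distribˡ-⋁ {ℕ.suc n} x p =
    trans (∧-distribˡ-∨ x (p zero) _) (∨-congˡ (∧-distribˡ-⋁ x (p ∘ suc)))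

  module _ (α : Carrier → Carrier) (α-⊥ : α ⊥ ≈ ⊥)
           (α-∨ : ∀ x y → α (x ∨ y) ≈ α x ∨ α y) where

    ⋁-homo : ∀ {n} (p : Fin n → Carrier) → α (⋁ 𝔸 p) ≈ ⋁ 𝔸 (α ∘ p)
    ⋁-homo {ℕ.zero}  p = α-⊥
    ⋁-homo {ℕ.suc n} p = trans (α-∨ _ _) (∨-congˡ (⋁-homo (p ∘ suc)))

  select : ∀ {n s} {S : Pred (Fin n) s} → Decidable S → (Fin n → Carrier) → Fin n → Carrier
  select S? p i with S? i
  ... | yes _ = p i
  ... | no _  = ⊥

  select-∈ : ∀ {n s} {S : Pred (Fin n) s} (S? : Decidable S) (p : Fin n → Carrier) {i} →
             S i → select S? p i ≈ p i
  select-∈ S? p {i} i∈S with S? i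
  ... | yes _   = ≈-refl
  ... | no i∉S = ⊥-elim (i∉S i∈S)

  ⋁⟨_⟩_ : ∀ {n s} {S : Pred (Fin n) s} → Decidable S → (Fin n → Carrier) → Carrier
  ⋁⟨ S? ⟩ p = ⋁ 𝔸 (select S? p)

  module _ {n} {p : Fin n → Carrier} (partition : IsPartition 𝔸 p) where
    open IsPartition partition

    ≈⋁-∧-blocks : ∀ x → x ≈ ⋁ 𝔸 (λ j → x ∧ p j)
    ≈⋁-∧-blocks x = begin
      x              ≈⟨ sym (∧-identityʳ x) ⟩
      x ∧ ⊤          ≈⟨ ∧-congˡ (sym covers) ⟩
      x ∧ ⋁ 𝔸 p      ≈⟨ ∧-distribˡ-⋁ x p ⟩
      ⋁ 𝔸 (λ j → x ∧ p j) ∎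

    module _ {s} {S : Pred (Fin n) s} (S? : Decidable S) where

      ⋁⟨⟩-nonzero : ∀ {a} → S a → ⋁⟨ S? ⟩ p ≉ ⊥
      ⋁⟨⟩-nonzero {a} a∈S ⋁≈⊥ = nonzero a (≤⊥⇒≈⊥ pa≤⊥)
        where
        pa≤⊥ : p a ≤ ⊥
        pa≤⊥ = ≤-trans (≤-reflexive (sym (select-∈ S? p a∈S)))
                       (≤-trans (x≤⋁ (select S? p) a) (≤-reflexive ⋁≈⊥))

      ∉⇒∧⋁⟨⟩≈⊥ : ∀ {b} → ¬ S b → p b ∧ ⋁⟨ S? ⟩ p ≈ ⊥
      ∉⇒∧⋁⟨⟩≈⊥ {b} b∉S =
        ≤⊥⇒≈⊥ (≤-trans (≤-reflexive (∧-distribˡ-⋁ (p b) (select S? p))) (⋁-least term≤⊥))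
        where
        term≤⊥ : ∀ j → p b ∧ select S? p j ≤ ⊥
        term≤⊥ j with S? j
        ... | no _    = ≤-reflexive (∧-zeroʳ (p b))
        ... | yes j∈S = ≤-reflexive (disjoint b j λ { ≡.refl → b∉S j∈S })

      ⋁⟨⟩≈⊤⇒universal : ⋁⟨ S? ⟩ p ≈ ⊤ → ∀ b → S b
      ⋁⟨⟩≈⊤⇒universal ⋁≈⊤ b with S? b
      ... | yes b∈S = b∈S
      ... | no b∉S  = ⊥-elim (nonzero b (begin
        p b                ≈⟨ sym (∧-identityʳ (p b)) ⟩
        p b ∧ ⊤            ≈⟨ ∧-congˡ (sym ⋁≈⊤) ⟩
        p b ∧ ⋁⟨ S? ⟩ p    ≈⟨ ∉⇒∧⋁⟨⟩≈⊥ b∉S ⟩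
        ⊥                  ∎))

      module _ (α : Carrier → Carrier) (α-⊥ : α ⊥ ≈ ⊥)
               (α-∨ : ∀ x y → α (x ∨ y) ≈ α x ∨ α y)
               (closed : ∀ {i j} → S i → ¬ S j → α (p i) ∧ p j ≈ ⊥) where

        α-block≤select : ∀ {i} → S i → ∀ j → α (p i) ∧ p j ≤ select S? p j
        α-block≤select i∈S j with S? j
        ... | yes _   = x∧y≤y _ _
        ... | no j∉S = ≤-reflexive (closed i∈S j∉S)

        ⋁⟨⟩-invariant : α (⋁⟨ S? ⟩ p) ≤ ⋁⟨ S? ⟩ p
        ⋁⟨⟩-invariant =
          ≤-trans (≤-reflexive (⋁-homo α α-⊥ α-∨ (select S? p))) (⋁-least α-select≤)
          where
          α-select≤ : ∀ i → α (select S? p i) ≤ ⋁⟨ S? ⟩ p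
          α-select≤ i with S? i
          ... | no _    = ≤-trans (≤-reflexive α-⊥) (⊥≤ _)
          ... | yes i∈S = ≤-trans (≤-reflexive (≈⋁-∧-blocks (α (p i))))
                            (⋁-least λ j → ≤-trans (α-block≤select i∈S j) (x≤⋁ (select S? p) j))

  incompressible⇒stronglyConnected :
    ExcludedMiddle ℓ → (α : Carrier → Carrier) → α ⊥ ≈ ⊥ →
    (∀ x y → α (x ∨ y) ≈ α x ∨ α y) → Incompressible 𝔸 α →
    ∀ n (p : Fin n → Carrier) → IsPartition 𝔸 p → StronglyConnected (Edge 𝔸 α p)
  incompressible⇒stronglyConnected em α α-⊥ α-∨ incompressible n p partition a =
    ⋁⟨⟩≈⊤⇒universal partition Reachable? y≈⊤
    where
    dne : DoubleNegationElimination ℓ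
    dne = em⇒dne em
    Reachable? : Decidable (Star (Edge 𝔸 α p) a)
    Reachable? _ = em
    y : Carrier
    y = ⋁⟨ Reachable? ⟩ p
    αy≤y : α y ≤ y
    αy≤y = ⋁⟨⟩-invariant partition Reachable? α α-⊥ α-∨
             (λ reach-i unreach-j → dne λ edge → unreach-j (reach-i ◅◅ edge ◅ ε))
    y≈⊤ : y ≈ ⊤
    y≈⊤ = dne λ y≉⊤ →
      incompressible (y , ⋁⟨⟩-nonzero partition Reachable? ε , y≉⊤ , ≤⇒≤ᴮ αy≤y)

  bipartition : Carrier → Fin 2 → Carrier
  bipartition x zero       = x
  bipartition x (suc zero) = ∁ x

  bipartition-isPartition : ∀ {x} → x ≉ ⊥ → x ≉ ⊤ → IsPartition 𝔸 (bipartition x)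
  bipartition-isPartition {x} x≉⊥ x≉⊤ = record
    { nonzero  = λ { zero → x≉⊥ ; (suc zero) → x≉⊤ ∘ ∁≈⊥⇒≈⊤ }
    ; disjoint = disjoint
    ; covers   = trans (∨-congˡ (∨-identityʳ (∁ x))) (∨-complementʳ x)
    }
    where
    disjoint : ∀ i j → ¬ i ≡ j → bipartition x i ∧ bipartition x j ≈ ⊥
    disjoint zero       zero       i≢j = ⊥-elim (i≢j ≡.refl)
    disjoint zero       (suc zero) _   = ∧-complementʳ x
    disjoint (suc zero) zero       _   = ∧-complementˡ x
    disjoint (suc zero) (suc zero) i≢j = ⊥-elim (i≢j ≡.refl)

  stronglyConnected⇒incompressible :
    (α : Carrier → Carrier) →
    (∀ n (p : Fin n → Carrier) → IsPartition 𝔸 p → StronglyConnected (Edge 𝔸 α p)) →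
    Incompressible 𝔸 α
  stronglyConnected⇒incompressible α connected (x , x≉⊥ , x≉⊤ , αx≤x) =
    one≢zero (Star-preserves (_≡ zero) stays-at-x walk ≡.refl)
    where
    walk : Star (Edge 𝔸 α (bipartition x)) zero (suc zero)
    walk = connected 2 (bipartition x) (bipartition-isPartition x≉⊥ x≉⊤) zero (suc zero)
    stays-at-x : ∀ {i j} → Edge 𝔸 α (bipartition x) i j → i ≡ zero → j ≡ zero
    stays-at-x {j = zero}     _    _    = ≡.refl
    stays-at-x {j = suc zero} edge ≡.refl = ⊥-elim (edge (≤⇒∧∁≈⊥ (≤ᴮ⇒≤ αx≤x)))
    one≢zero : ¬ Fin.suc {1} zero ≡ zero
    one≢zero ()

theorem7p6 : {c ℓ : Level} → ExcludedMiddle ℓ →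
    (𝔸 : BooleanAlgebra c ℓ) → (α : BooleanAlgebra.Carrier 𝔸 → BooleanAlgebra.Carrier 𝔸) →
    IsAutomorphism 𝔸 α →
    Incompressible 𝔸 α ⇔
      ((n : ℕ) (p : Fin n → BooleanAlgebra.Carrier 𝔸) → IsPartition 𝔸 p →
        StronglyConnected (Edge 𝔸 α p))
theorem7p6 em 𝔸 α automorphism =
  mk⇔ (incompressible⇒stronglyConnected 𝔸 em α ⊥-homo ∨-homo)
      (stronglyConnected⇒incompressible 𝔸 α)
  where open IsAutomorphism automorphism
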